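{- Let $k\ge0$ be an integer, $s\in[[0,2^k-1]]$, $i\in[[0,\mathrm{last}_{k,s}]]$ and $l\in[[0,l_{k,s,i}]]$. Then $X_{k,s,i,l}=\{\mathrm{rev}_k(t_{k,s,i}+\lfloor 2^{l-1}\rfloor)+2^{k-l+1}\cdot x' : x'\in[[0,\lceil 2^{l-1}\rceil-1]]\}$ and $\mathrm{rev}_k(t_{k,s,i}+\lfloor 2^{l-1}\rfloor)<2^{k-l+1}$.
   Context: $[[a,b]]=\{x\in\mathbb{Z}: a\le x\le b\}$, $n=2^k$. For $x=\sum_{i=0}^{k-1}x_i2^i\in[[0,2^k-1]]$, $\mathrm{rev}_k(x)=\sum_{i=0}^{k-1}x_i2^{k-1-i}$; for a set $S$, $\mathrm{rev}_k S=\{\mathrm{rev}_k(x):x\in S\}$. Define $t_{k,s,0}=s$, $l_{k,s,i}=\max\{l\in[[0,k]] : t_{k,s,i}\bmod 2^l=0\}$, $t_{k,s,i+1}=(t_{k,s,i}+2^{l_{k,s,i}})\bmod n$, and $\mathrm{last}_{k,s}=\min\{i\ge0: t_{k,s,i}=0\}$. For $0\le i\le\mathrm{last}_{k,s}$ and $0\le l\le l_{k,s,i}$ let $Y_{k,s,i,l}=[[t_{k,s,i}+\lfloor 2^{l-1}\rfloor,\ t_{k,s,i}+2^l-1]]$ (so $Y_{k,s,i,0}=\{t_{k,s,i}\}$) and $X_{k,s,i,l}=\mathrm{rev}_k Y_{k,s,i,l}$. -}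

module Defs where

open import Data.Nat using (ℕ; zero; suc; _+_; _*_; _∸_; _^_; _≤_; _<_; _≟_)
open import Data.Nat.Properties using (m^n≢0)
open import Data.Nat.DivMod using (_/_; _%_)
open import Data.List using (map; upTo)
open import Data.Nat.ListAction using (sum)
open import Data.Bool using (if_then_else_)
open import Data.Product using (∃-syntax; _×_)
open import Relation.Nullary using (does; ¬_)
open import Relation.Binary.PropositionalEquality using (_≡_)

_%2^_ : ℕ → ℕ → ℕ
x %2^ m = _%_ x (2 ^ m) {{m^n≢0 2 m}}

_/2^_ : ℕ → ℕ → ℕ
x /2^ m = _/_ x (2 ^ m) {{m^n≢0 2 m}}

bit : ℕ → ℕ → ℕ
bit x i = (x /2^ i) % 2

rev : ℕ → ℕ → ℕ
rev k x = sum (map (λ i → bit x i * 2 ^ (k ∸ 1 ∸ i)) (upTo k))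

maxL : ℕ → ℕ → ℕ
maxL zero t = zero
maxL (suc m) t = if does (t %2^ suc m ≟ 0) then suc m else maxL m t

tt : ℕ → ℕ → ℕ → ℕ
ll : ℕ → ℕ → ℕ → ℕ

tt k s zero = s
tt k s (suc i) = (tt k s i + 2 ^ ll k s i) %2^ k

ll k s i = maxL k (tt k s i)

IsLast : ℕ → ℕ → ℕ → Set
IsLast k s m = (tt k s m ≡ 0) × (∀ j → j < m → ¬ (tt k s j ≡ 0))

-- ⌊2^{l-1}⌋ and ⌈2^{l-1}⌉
floorHalf : ℕ → ℕ
floorHalf l = (2 ^ l) / 2

ceilHalf : ℕ → ℕ
ceilHalf l = (2 ^ l + 1) / 2

InX : ℕ → ℕ → ℕ → ℕ → ℕ → Set
InX k s i l y = ∃[ x ] ((tt k s i + floorHalf l ≤ x) × (x ≤ tt k s i + 2 ^ l ∸ 1) × (rev k x ≡ y))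

InRHS : ℕ → ℕ → ℕ → ℕ → ℕ → Set
InRHS k s i l y = ∃[ x' ] ((x' ≤ ceilHalf l ∸ 1) × (y ≡ rev k (tt k s i + floorHalf l) + 2 ^ (k ∸ l + 1) * x'))

module Submission where

-- Bit reversal moves low bits to high positions: if 2 ^ m divides b and j < 2 ^ m, then
-- rev k (b + j) = rev k b + 2 ^ (k - m) * rev m j, with rev k b < 2 ^ (k - m).  As rev m permutes
-- [0, 2 ^ m), rev k maps the aligned block [b, b + 2 ^ m) onto the progression with start rev k b
-- and step 2 ^ (k - m).  Y_{k,s,i,l} is such a block with m = l - 1 and b = t_{k,s,i} + ⌊2^{l-1}⌋,
-- since 2 ^ l divides t_{k,s,i} by the choice of l_{k,s,i}; nothing else about s, i or last is used.

open import Defs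
open import Data.Nat using (ℕ; zero; suc; _+_; _*_; _∸_; _^_; _≤_; _<_; z≤n; s≤s; z<s; pred; _≡ᵇ_; _/_; _%_)
open import Data.Nat.Properties
open import Data.Nat.DivMod
open import Data.Nat.Divisibility using (_∣_; divides; ∣-trans; ∣m∣n⇒∣m+n; ∣-reflexive; 1∣_; m∣m*n; ∣n⇒∣m*n; m%n≡0⇒n∣m)
open import Data.Nat.Solver using (module +-*-Solver)
open +-*-Solver using (solve; _:=_; _:+_; _:*_; con)
open import Data.List using (applyUpTo)
open import Data.List.Properties using (map-upTo)
open import Data.Nat.ListAction using (sum)
open import Data.Product using (_×_; _,_; ∃-syntax)
open import Function.Bundles using (_⇔_; mk⇔; module Equivalence)
open import Data.Bool using (true; false; T)
open import Function.Properties.Equivalence using (⇔-setoid)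
open import Level using (0ℓ)
import Relation.Binary.Reasoning.Setoid as SetoidReasoning
open import Relation.Binary.PropositionalEquality

bitrev : ℕ → ℕ → ℕ
bitrev zero    x = 0
bitrev (suc k) x = x % 2 * 2 ^ k + bitrev k (x / 2)

bit-suc : ∀ x i → bit x (suc i) ≡ bit (x / 2) i
bit-suc x i = cong (_% 2) (sym (m/n/o≡m/[n*o] x 2 (2 ^ i) {{_}} {{m^n≢0 2 i}} {{m^n≢0 2 (suc i)}}))

sum-applyUpTo-cong : ∀ {f g : ℕ → ℕ} n → (∀ i → f i ≡ g i) → sum (applyUpTo f n) ≡ sum (applyUpTo g n)
sum-applyUpTo-cong zero    f≗g = refl
sum-applyUpTo-cong (suc n) f≗g = cong₂ _+_ (f≗g 0) (sum-applyUpTo-cong n (λ i → f≗g (suc i)))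

rev≡bitrev : ∀ k x → rev k x ≡ bitrev k x
rev≡bitrev k x = trans (cong sum (map-upTo _ k)) (sum≡bitrev k x)
  where
  sum≡bitrev : ∀ k x → sum (applyUpTo (λ i → bit x i * 2 ^ (k ∸ 1 ∸ i)) k) ≡ bitrev k x
  sum≡bitrev zero    x = refl
  sum≡bitrev (suc k) x = cong₂ _+_
    (cong (λ b → b % 2 * 2 ^ k) (n/1≡n x))
    (trans (sum-applyUpTo-cong k (λ i → cong₂ (λ b e → b * 2 ^ e) (bit-suc x i) (sym (∸-+-assoc k 1 i))))
           (sum≡bitrev k (x / 2)))

bitrev< : ∀ k x → bitrev k x < 2 ^ k
bitrev< zero    x = z<s
bitrev< (suc k) x = begin-strict
  x % 2 * 2 ^ k + bitrev k (x / 2) <⟨ +-monoʳ-< (x % 2 * 2 ^ k) (bitrev< k (x / 2)) ⟩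
  x % 2 * 2 ^ k + 2 ^ k            ≤⟨ +-monoˡ-≤ (2 ^ k) (*-monoˡ-≤ (2 ^ k) (≤-pred (m%n<n x 2))) ⟩
  1 * 2 ^ k + 2 ^ k                ≡⟨ +-comm (1 * 2 ^ k) (2 ^ k) ⟩
  2 ^ suc k                        ∎
  where open ≤-Reasoning

bitrev-split : ∀ m n q j → j < 2 ^ m → bitrev (m + n) (q * 2 ^ m + j) ≡ bitrev n q + 2 ^ n * bitrev m j
bitrev-split zero n q j j<1 rewrite n<1⇒n≡0 j<1 = begin
  bitrev n (q * 1 + 0)     ≡⟨ cong (bitrev n) (trans (+-identityʳ (q * 1)) (*-identityʳ q)) ⟩
  bitrev n q               ≡⟨ sym (+-identityʳ (bitrev n q)) ⟩
  bitrev n q + 0           ≡⟨ cong (bitrev n q +_) (sym (*-zeroʳ (2 ^ n))) ⟩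
  bitrev n q + 2 ^ n * 0   ∎
  where open ≡-Reasoning
bitrev-split (suc m) n q j j< = begin
  x % 2 * 2 ^ (m + n) + bitrev (m + n) (x / 2)
    ≡⟨ cong₂ (λ r h → r * 2 ^ (m + n) + bitrev (m + n) h) low high ⟩
  j % 2 * 2 ^ (m + n) + bitrev (m + n) (q * 2 ^ m + j / 2)
    ≡⟨ cong₂ (λ p b → j % 2 * p + b) (^-distribˡ-+-* 2 m n) (bitrev-split m n q (j / 2) j/2<) ⟩
  j % 2 * (2 ^ m * 2 ^ n) + (bitrev n q + 2 ^ n * bitrev m (j / 2))
    ≡⟨ solve 5 (λ r P N B Q → r :* (P :* N) :+ (B :+ N :* Q) := B :+ N :* (r :* P :+ Q)) refl
         (j % 2) (2 ^ m) (2 ^ n) (bitrev n q) (bitrev m (j / 2)) ⟩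
  bitrev n q + 2 ^ n * bitrev (suc m) j
    ∎
  where
  open ≡-Reasoning
  x = q * 2 ^ suc m + j
  2∣q2^[1+m] : 2 ∣ q * 2 ^ suc m
  2∣q2^[1+m] = ∣n⇒∣m*n q (m∣m*n (2 ^ m))
  low : x % 2 ≡ j % 2
  low = %-remove-+ˡ j 2∣q2^[1+m]
  high : x / 2 ≡ q * 2 ^ m + j / 2
  high = trans (+-distrib-/-∣ˡ j 2∣q2^[1+m])
    (cong (_+ j / 2) (trans (cong (_/ 2) (solve 2 (λ q P → q :* (con 2 :* P) := q :* P :* con 2) refl q (2 ^ m)))
                            (m*n/n≡m (q * 2 ^ m) 2)))
  j/2< : j / 2 < 2 ^ m
  j/2< = m<n*o⇒m/o<n (subst (j <_) (*-comm 2 (2 ^ m)) j<)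

bitrev-involutive : ∀ m x → x < 2 ^ m → bitrev m (bitrev m x) ≡ x
bitrev-involutive zero    x x<1 = sym (n<1⇒n≡0 x<1)
bitrev-involutive (suc m) x x<  = begin
  bitrev (suc m) (x % 2 * 2 ^ m + bitrev m (x / 2))
    ≡⟨ cong (λ k → bitrev k (x % 2 * 2 ^ m + bitrev m (x / 2))) (+-comm 1 m) ⟩
  bitrev (m + 1) (x % 2 * 2 ^ m + bitrev m (x / 2))
    ≡⟨ bitrev-split m 1 (x % 2) (bitrev m (x / 2)) (bitrev< m (x / 2)) ⟩
  x % 2 % 2 * 1 + 0 + 2 * bitrev m (bitrev m (x / 2))
    ≡⟨ cong₂ (λ r h → r * 1 + 0 + 2 * h) (m%n%n≡m%n x 2) (bitrev-involutive m (x / 2) x/2<) ⟩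
  x % 2 * 1 + 0 + 2 * (x / 2)
    ≡⟨ solve 2 (λ r h → r :* con 1 :+ con 0 :+ con 2 :* h := r :+ h :* con 2) refl (x % 2) (x / 2) ⟩
  x % 2 + x / 2 * 2
    ≡⟨ sym (m≡m%n+[m/n]*n x 2) ⟩
  x ∎
  where
  open ≡-Reasoning
  x/2< : x / 2 < 2 ^ m
  x/2< = m<n*o⇒m/o<n (subst (x <_) (*-comm 2 (2 ^ m)) x<)

bitrev-zero : ∀ m → bitrev m 0 ≡ 0
bitrev-zero zero    = refl
bitrev-zero (suc m) = bitrev-zero m

rev-aligned : ∀ {k m} q j → m ≤ k → j < 2 ^ m →
              rev k (q * 2 ^ m + j) ≡ bitrev (k ∸ m) q + 2 ^ (k ∸ m) * bitrev m j
rev-aligned {k} {m} q j m≤k j< = trans (rev≡bitrev k _)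
  (subst (λ k′ → bitrev k′ (q * 2 ^ m + j) ≡ bitrev (k ∸ m) q + 2 ^ (k ∸ m) * bitrev m j)
         (m+[n∸m]≡n m≤k) (bitrev-split m (k ∸ m) q j j<))

rev-aligned-start : ∀ {k m} q → m ≤ k → rev k (q * 2 ^ m) ≡ bitrev (k ∸ m) q
rev-aligned-start {k} {m} q m≤k = begin
  rev k (q * 2 ^ m)                               ≡⟨ cong (rev k) (sym (+-identityʳ (q * 2 ^ m))) ⟩
  rev k (q * 2 ^ m + 0)                           ≡⟨ rev-aligned q 0 m≤k (m^n>0 2 m) ⟩
  bitrev (k ∸ m) q + 2 ^ (k ∸ m) * bitrev m 0     ≡⟨ cong (λ r → bitrev (k ∸ m) q + 2 ^ (k ∸ m) * r) (bitrev-zero m) ⟩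
  bitrev (k ∸ m) q + 2 ^ (k ∸ m) * 0              ≡⟨ cong (bitrev (k ∸ m) q +_) (*-zeroʳ (2 ^ (k ∸ m))) ⟩
  bitrev (k ∸ m) q + 0                            ≡⟨ +-identityʳ _ ⟩
  bitrev (k ∸ m) q                                ∎
  where open ≡-Reasoning

rev-aligned< : ∀ {k m b} → m ≤ k → 2 ^ m ∣ b → rev k b < 2 ^ (k ∸ m)
rev-aligned< {k} {m} m≤k (divides q refl) =
  subst (_< 2 ^ (k ∸ m)) (sym (rev-aligned-start q m≤k)) (bitrev< (k ∸ m) q)

rev-aligned-offset : ∀ {k m b} j → m ≤ k → 2 ^ m ∣ b → j < 2 ^ m →
                     rev k (b + j) ≡ rev k b + 2 ^ (k ∸ m) * bitrev m j
rev-aligned-offset {k} {m} j m≤k (divides q refl) j< =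
  trans (rev-aligned q j m≤k j<) (cong (_+ 2 ^ (k ∸ m) * bitrev m j) (sym (rev-aligned-start q m≤k)))

RevImage : ℕ → ℕ → ℕ → ℕ → Set
RevImage k b n y = ∃[ x ] ((b ≤ x) × (x < b + n) × (rev k x ≡ y))

Progression : ℕ → ℕ → ℕ → ℕ → Set
Progression a d n y = ∃[ x′ ] ((x′ < n) × (y ≡ a + d * x′))

rev-image-aligned : ∀ {k m b} → m ≤ k → 2 ^ m ∣ b →
                    ∀ y → RevImage k b (2 ^ m) y ⇔ Progression (rev k b) (2 ^ (k ∸ m)) (2 ^ m) y
rev-image-aligned {k} {m} {b} m≤k 2^m∣b y = mk⇔ to from
  where
  open ≡-Reasoning
  to : RevImage k b (2 ^ m) y → Progression (rev k b) (2 ^ (k ∸ m)) (2 ^ m) y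
  to (x , b≤x , x<b+2^m , rx≡y) = bitrev m j , bitrev< m j , y≡
    where
    j = x ∸ b
    b+j≡x : b + j ≡ x
    b+j≡x = m+[n∸m]≡n b≤x
    j< : j < 2 ^ m
    j< = +-cancelˡ-< b j (2 ^ m) (subst (_< b + 2 ^ m) (sym b+j≡x) x<b+2^m)
    y≡ : y ≡ rev k b + 2 ^ (k ∸ m) * bitrev m j
    y≡ = begin
      y                                      ≡⟨ sym rx≡y ⟩
      rev k x                                ≡⟨ cong (rev k) (sym b+j≡x) ⟩
      rev k (b + j)                          ≡⟨ rev-aligned-offset j m≤k 2^m∣b j< ⟩
      rev k b + 2 ^ (k ∸ m) * bitrev m j     ∎
  from : Progression (rev k b) (2 ^ (k ∸ m)) (2 ^ m) y → RevImage k b (2 ^ m) y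
  from (x′ , x′< , y≡) = b + j , m≤m+n b j , +-monoʳ-< b (bitrev< m x′) , rev≡y
    where
    j = bitrev m x′
    rev≡y : rev k (b + j) ≡ y
    rev≡y = begin
      rev k (b + j)                     ≡⟨ rev-aligned-offset j m≤k 2^m∣b (bitrev< m x′) ⟩
      rev k b + 2 ^ (k ∸ m) * bitrev m j ≡⟨ cong (λ z → rev k b + 2 ^ (k ∸ m) * z) (bitrev-involutive m x′ x′<) ⟩
      rev k b + 2 ^ (k ∸ m) * x′         ≡⟨ sym y≡ ⟩
      y                                  ∎

maxL≤ : ∀ k t → maxL k t ≤ k
maxL≤ zero    t = z≤n
maxL≤ (suc m) t with t %2^ suc m ≡ᵇ 0
... | true  = ≤-refl
... | false = m≤n⇒m≤1+n (maxL≤ m t)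

2^maxL∣ : ∀ k t → 2 ^ maxL k t ∣ t
2^maxL∣ zero    t = 1∣ t
2^maxL∣ (suc m) t with t %2^ suc m ≡ᵇ 0 in divisible
... | true  = m%n≡0⇒n∣m t (2 ^ suc m) {{m^n≢0 2 (suc m)}} (≡ᵇ⇒≡ (t %2^ suc m) 0 (subst T (sym divisible) _))
... | false = 2^maxL∣ m t

^-monoʳ-∣ : ∀ b {m n} → m ≤ n → b ^ m ∣ b ^ n
^-monoʳ-∣ b {m} {n} m≤n = divides (b ^ (n ∸ m)) (begin
  b ^ n               ≡⟨ cong (b ^_) (sym (m∸n+n≡m m≤n)) ⟩
  b ^ (n ∸ m + m)     ≡⟨ ^-distribˡ-+-* b (n ∸ m) m ⟩
  b ^ (n ∸ m) * b ^ m ∎)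
  where open ≡-Reasoning

floorHalf-suc : ∀ m → floorHalf (suc m) ≡ 2 ^ m
floorHalf-suc m = trans (cong (_/ 2) (*-comm 2 (2 ^ m))) (m*n/n≡m (2 ^ m) 2)

ceilHalf≡2^pred : ∀ l → ceilHalf l ≡ 2 ^ pred l
ceilHalf≡2^pred zero    = refl
ceilHalf≡2^pred (suc m) = begin
  (2 * 2 ^ m + 1) / 2       ≡⟨ +-distrib-/-∣ˡ 1 (m∣m*n (2 ^ m)) ⟩
  2 * 2 ^ m / 2 + 1 / 2     ≡⟨ +-identityʳ _ ⟩
  2 * 2 ^ m / 2             ≡⟨ floorHalf-suc m ⟩
  2 ^ m                     ∎
  where open ≡-Reasoning

floorHalf+ceilHalf : ∀ l → floorHalf l + ceilHalf l ≡ 2 ^ l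
floorHalf+ceilHalf zero    = refl
floorHalf+ceilHalf (suc m) = begin
  floorHalf (suc m) + ceilHalf (suc m) ≡⟨ cong₂ _+_ (floorHalf-suc m) (ceilHalf≡2^pred (suc m)) ⟩
  2 ^ m + 2 ^ m                        ≡⟨ cong (2 ^ m +_) (sym (+-identityʳ (2 ^ m))) ⟩
  2 ^ suc m                            ∎
  where open ≡-Reasoning

2^pred∣floorHalf : ∀ l → 2 ^ pred l ∣ floorHalf l
2^pred∣floorHalf zero    = divides 0 refl
2^pred∣floorHalf (suc m) = ∣-reflexive (sym (floorHalf-suc m))

≤pred⇔< : ∀ {m n} → 0 < n → m ≤ pred n ⇔ m < n
≤pred⇔< {n = suc n} _ = mk⇔ s≤s ≤-pred

InX⇔RevImage : ∀ k s i l y → InX k s i l y ⇔ RevImage k (tt k s i + floorHalf l) (2 ^ pred l) y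
InX⇔RevImage k s i l y =
  mk⇔ (λ (x , lo , hi , rx≡y) → x , lo , Equivalence.to (below-end x) hi , rx≡y)
      (λ (x , lo , hi , rx≡y) → x , lo , Equivalence.from (below-end x) hi , rx≡y)
  where
  t = tt k s i
  end : t + 2 ^ l ≡ t + floorHalf l + 2 ^ pred l
  end = begin
    t + 2 ^ l                          ≡⟨ cong (t +_) (sym (floorHalf+ceilHalf l)) ⟩
    t + (floorHalf l + ceilHalf l)     ≡⟨ sym (+-assoc t (floorHalf l) (ceilHalf l)) ⟩
    t + floorHalf l + ceilHalf l       ≡⟨ cong (t + floorHalf l +_) (ceilHalf≡2^pred l) ⟩
    t + floorHalf l + 2 ^ pred l       ∎
    where open ≡-Reasoning
  below-end : ∀ x → x ≤ pred (t + 2 ^ l) ⇔ x < t + floorHalf l + 2 ^ pred l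
  below-end x = subst (λ N → x ≤ pred (t + 2 ^ l) ⇔ x < N) end
                      (≤pred⇔< (<-≤-trans (m^n>0 2 l) (m≤n+m (2 ^ l) t)))

InRHS⇔Progression : ∀ k s i l y →
  InRHS k s i l y ⇔ Progression (rev k (tt k s i + floorHalf l)) (2 ^ (k ∸ l + 1)) (2 ^ pred l) y
InRHS⇔Progression k s i l y =
  mk⇔ (λ (x′ , x′≤ , y≡) → x′ , Equivalence.to below-ceil x′≤ , y≡)
      (λ (x′ , x′< , y≡) → x′ , Equivalence.from below-ceil x′< , y≡)
  where
  below-ceil : ∀ {x′} → x′ ≤ pred (ceilHalf l) ⇔ x′ < 2 ^ pred l
  below-ceil {x′} = subst (λ c → x′ ≤ pred (ceilHalf l) ⇔ x′ < c) (ceilHalf≡2^pred l)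
                          (≤pred⇔< (subst (0 <_) (sym (ceilHalf≡2^pred l)) (m^n>0 2 (pred l))))

m∸pred[n]≤m∸n+1 : ∀ m n → m ∸ pred n ≤ m ∸ n + 1
m∸pred[n]≤m∸n+1 m       zero          = m≤m+n m 1
m∸pred[n]≤m∸n+1 zero    (suc n)       = ≤-trans (≤-reflexive (0∸n≡0 n)) z≤n
m∸pred[n]≤m∸n+1 (suc m) (suc zero)    = ≤-reflexive (+-comm 1 m)
m∸pred[n]≤m∸n+1 (suc m) (suc (suc n)) = m∸pred[n]≤m∸n+1 m (suc n)

progression-singleton : ∀ a d d′ y → Progression a d 1 y ⇔ Progression a d′ 1 y
progression-singleton a d d′ y = mk⇔ (restep d d′) (restep d′ d)
  where
  restep : ∀ e e′ → Progression a e 1 y → Progression a e′ 1 y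
  restep e e′ (x′ , x′<1 , y≡) rewrite n<1⇒n≡0 x′<1 =
    0 , z<s , trans y≡ (cong (a +_) (trans (*-zeroʳ e) (sym (*-zeroʳ e′))))

-- For l = 0 the progression has a single term, so the statement's step 2 ^ (k + 1) is harmless.
progression-step : ∀ {k l} a y → l ≤ k →
  Progression a (2 ^ (k ∸ pred l)) (2 ^ pred l) y ⇔ Progression a (2 ^ (k ∸ l + 1)) (2 ^ pred l) y
progression-step {k}     {zero}  a y _ = progression-singleton a (2 ^ k) (2 ^ (k + 1)) y
progression-step {suc k} {suc m} a y (s≤s m≤k) =
  subst (λ e → Progression a (2 ^ (suc k ∸ m)) (2 ^ m) y ⇔ Progression a (2 ^ e) (2 ^ m) y)
        (trans (+-∸-assoc 1 m≤k) (+-comm 1 (k ∸ m)))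
        (mk⇔ (λ p → p) (λ p → p))

lemma2 : (k s : ℕ) → s < 2 ^ k → (i last : ℕ) → IsLast k s last → i ≤ last →
         (l : ℕ) → l ≤ ll k s i →
         ((y : ℕ) → InX k s i l y ⇔ InRHS k s i l y) ×
         (rev k (tt k s i + floorHalf l) < 2 ^ (k ∸ l + 1))
lemma2 k s _ i _ _ _ l l≤ll = block , <-≤-trans (rev-aligned< pred[l]≤k b-aligned) (^-monoʳ-≤ 2 (m∸pred[n]≤m∸n+1 k l))
  where
  t = tt k s i
  b = t + floorHalf l
  l≤k : l ≤ k
  l≤k = ≤-trans l≤ll (maxL≤ k t)
  pred[l]≤k : pred l ≤ k
  pred[l]≤k = ≤-trans pred[n]≤n l≤k
  2^l∣t : 2 ^ l ∣ t
  2^l∣t = ∣-trans (^-monoʳ-∣ 2 l≤ll) (2^maxL∣ k t)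
  b-aligned : 2 ^ pred l ∣ b
  b-aligned = ∣m∣n⇒∣m+n (∣-trans (^-monoʳ-∣ 2 (pred[n]≤n {l})) 2^l∣t) (2^pred∣floorHalf l)
  block : (y : ℕ) → InX k s i l y ⇔ InRHS k s i l y
  block y = begin
    InX k s i l y                                                  ≈⟨ InX⇔RevImage k s i l y ⟩
    RevImage k b (2 ^ pred l) y                                    ≈⟨ rev-image-aligned pred[l]≤k b-aligned y ⟩
    Progression (rev k b) (2 ^ (k ∸ pred l)) (2 ^ pred l) y        ≈⟨ progression-step (rev k b) y l≤k ⟩
    Progression (rev k b) (2 ^ (k ∸ l + 1)) (2 ^ pred l) y         ≈⟨ InRHS⇔Progression k s i l y ⟨
    InRHS k s i l y                                                ∎
    where open SetoidReasoning (⇔-setoid 0ℓ)
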